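{- Let $k\geq 2$. Then $D(P_{3k,k})\leq \lfloor 3k/2\rfloor+2$.
   Context: For positive integers $n,k$ with $2\le 2k<n$, the generalised Petersen graph $P_{n,k}$ has vertex set $\{u_i,v_i: i\in\{0,\dots,n-1\}\}$ and edge set $\{u_iu_{i+1}, v_iv_{i+k}, u_iv_i : i\in\{0,\dots,n-1\}\}$, indices modulo $n$. A signed graph $(G,E_-)$ is a simple graph $G$ with a set $E_-\subseteq E(G)$ of negative edges; other edges are positive. A cycle is positive if the product of its edge signs is positive; a signed graph is balanced if every cycle is positive. The frustration index $l(G,E_-)$ is the minimum number of edges whose deletion leaves a balanced signed graph, and the maximum frustration is $D(G)=\max_{E_-\subseteq E(G)} l(G,E_-)$. -}

module Defs where

open import Data.Nat using (ℕ; zero; suc; _+_; _*_; _≤_; _%_)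
open import Data.Nat.DivMod using (_mod_)
open import Data.Bool using (Bool; true; false; if_then_else_)
open import Data.Fin using (Fin; toℕ) renaming (zero to fzero; suc to fsuc)
open import Data.Product using (_×_; _,_; Σ; ∃)
open import Data.Sum using (_⊎_)
open import Relation.Binary.PropositionalEquality using (_≡_)
open import Function.Definitions using (Injective)

addMod : {n : ℕ} → Fin n → ℕ → Fin n
addMod {suc n} i a = (toℕ i + a) mod (suc n)

-- Vertices of P_{n,k}: (false , i) is u_i, (true , i) is v_i
Vertex : ℕ → Set
Vertex n = Bool × Fin n

-- Edges of P_{n,k}, indexed by a type (0,1,2) and i ∈ {0..n-1}:
--   (0 , i) = u_i u_{i+1},  (1 , i) = v_i v_{i+k},  (2 , i) = u_i v_i.
-- For 2 ≤ 2k < n these 3n edges are pairwise distinct and the graph is simple.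
Edge : ℕ → Set
Edge n = Fin 3 × Fin n

ends : (n k : ℕ) → Edge n → Vertex n × Vertex n
ends n k (fzero , i) = (false , i) , (false , addMod i 1)
ends n k (fsuc fzero , i) = (true , i) , (true , addMod i k)
ends n k (fsuc (fsuc fzero) , i) = (false , i) , (true , i)

Joins : (n k : ℕ) → Edge n → Vertex n → Vertex n → Set
Joins n k e x y = (ends n k e ≡ (x , y)) ⊎ (ends n k e ≡ (y , x))

count : {m : ℕ} → (Fin m → Bool) → ℕ
count {zero} f = 0
count {suc m} f = (if f fzero then 1 else 0) + count (λ j → f (fsuc j))

-- subsets of edges (signatures E₋ and deletion sets) as Boolean predicates
EdgeSet : ℕ → Set
EdgeSet n = Edge n → Bool

next : {m : ℕ} → Fin m → Fin m
next i = addMod i 1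

record Cycle (n k : ℕ) (S : EdgeSet n) : Set where
  field
    len      : ℕ
    len≥3    : 3 ≤ len
    vert     : Fin len → Vertex n
    distinct : Injective _≡_ _≡_ vert
    edge     : Fin len → Edge n
    joins    : ∀ j → Joins n k (edge j) (vert j) (vert (next j))
    kept     : ∀ j → S (edge j) ≡ false

Positive : {n k : ℕ} {S : EdgeSet n} → EdgeSet n → Cycle n k S → Set
Positive Eneg C = count (λ j → Eneg (Cycle.edge C j)) % 2 ≡ 0

Balanced : (n k : ℕ) → (Eneg S : EdgeSet n) → Set
Balanced n k Eneg S = (C : Cycle n k S) → Positive Eneg C

size : {n : ℕ} → EdgeSet n → ℕ
size {n} S = count {3 * n} (λ j → S (decode j))
  where
  open import Data.Fin using (remQuot)
  decode : Fin (3 * n) → Edge n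
  decode j = remQuot {3} n j

FrustrationAtMost : (n k : ℕ) → EdgeSet n → ℕ → Set
FrustrationAtMost n k Eneg b =
  Σ (EdgeSet n) λ S → (size S ≤ b) × Balanced n k Eneg S

MaxFrustrationAtMost : (n k : ℕ) → ℕ → Set
MaxFrustrationAtMost n k b = (Eneg : EdgeSet n) → FrustrationAtMost n k Eneg b

module Submission where

-- For any switching σ of the vertices, deleting the edges that are negative after switching
-- leaves a balanced signed graph: along a remaining cycle the negative edges are exactly the
-- places where σ changes value, and a closed walk has an even number of them.  So it is
-- enough to find, for every signature of P_{3K,K}, a switching with few negative edges.
-- The inner rim of P_{3K,K} is the union of the K triangles v_j v_{j+K} v_{j+2K}.  We switch
-- u_m by the sign π m of the outer path u₀…u_m, flipped by b on the second and by c on the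
-- third block of K positions, and switch every triangle optimally given its spokes.  Then
-- only the three block boundaries of the outer rim can stay negative; summed over the four
-- choices of (b , c) the outer rim contributes 6 and every triangle at most 5 (a finite
-- check), so one choice leaves at most (5K + 6)/4 ≤ ⌊3K/2⌋ + 2 negative edges.

open import Defs
open import Data.Bool using (Bool; true; false; if_then_else_; _xor_; _∧_; T)
open import Data.Bool.Properties
  using (xor-assoc; xor-comm; xor-same; T-∧; not-distribˡ-xor; not-distribʳ-xor; xor-annihilates-not)
open import Data.Empty using (⊥-elim)
open import Data.Fin using (Fin; toℕ; _↑ˡ_; _↑ʳ_; remQuot) renaming (zero to fzero; suc to fsuc)
open import Data.Fin.Properties using (toℕ-injective; toℕ-fromℕ<; toℕ<n; splitAt-↑ˡ; splitAt-↑ʳ)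
open import Data.List using (List; []; _∷_)
open import Data.List.Extrema.Nat using (argmin)
open import Data.Nat
open import Data.Nat.DivMod
open import Data.Nat.Properties
open import Algebra.Properties.CommutativeSemigroup +-commutativeSemigroup
  using () renaming (interchange to +-interchange)
open import Data.Nat.Tactic.RingSolver using (solve-∀)
open import Data.Product using (_×_; _,_; proj₁; proj₂; map₁; ∃₂)
open import Data.Sum using (inj₁; inj₂)
open import Function using (_∘_)
open import Function.Bundles using (Equivalence)
open import Relation.Binary.PropositionalEquality
open import Relation.Nullary using (yes; no)

bit : Bool → ℕ
bit b = if b then 1 else 0

∑ : ℕ → (ℕ → ℕ) → ℕ
∑ zero f = 0
∑ (suc N) f = f 0 + ∑ N (f ∘ suc)

∑-cong : ∀ N {f g : ℕ → ℕ} → (∀ i → i < N → f i ≡ g i) → ∑ N f ≡ ∑ N g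
∑-cong zero eq = refl
∑-cong (suc N) eq = cong₂ _+_ (eq 0 z<s) (∑-cong N (λ i i<N → eq (suc i) (s<s i<N)))

∑-split : ∀ a b (f : ℕ → ℕ) → ∑ (a + b) f ≡ ∑ a f + ∑ b (λ i → f (a + i))
∑-split zero b f = refl
∑-split (suc a) b f = trans (cong (f 0 +_) (∑-split a b (f ∘ suc))) (sym (+-assoc (f 0) _ _))

∑-+ : ∀ N (f g : ℕ → ℕ) → ∑ N (λ i → f i + g i) ≡ ∑ N f + ∑ N g
∑-+ zero f g = refl
∑-+ (suc N) f g =
  trans (cong (f 0 + g 0 +_) (∑-+ N (f ∘ suc) (g ∘ suc))) (+-interchange (f 0) (g 0) _ _)

∑-mono : ∀ N {f g : ℕ → ℕ} → (∀ i → f i ≤ g i) → ∑ N f ≤ ∑ N g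
∑-mono zero le = z≤n
∑-mono (suc N) le = +-mono-≤ (le 0) (∑-mono N (le ∘ suc))

∑-const : ∀ N c → ∑ N (λ _ → c) ≡ N * c
∑-const zero c = refl
∑-const (suc N) c = cong (c +_) (∑-const N c)

count-cong : ∀ {N} {f g : Fin N → Bool} → (∀ i → f i ≡ g i) → count f ≡ count g
count-cong {zero} eq = refl
count-cong {suc N} eq = cong₂ _+_ (cong bit (eq fzero)) (count-cong (eq ∘ fsuc))

count-∑ : ∀ N (F : ℕ → Bool) → count {N} (F ∘ toℕ) ≡ ∑ N (bit ∘ F)
count-∑ zero F = refl
count-∑ (suc N) F = cong (bit (F 0) +_) (count-∑ N (F ∘ suc))

count-split : ∀ a b (f : Fin (a + b) → Bool) →
              count f ≡ count (λ i → f (i ↑ˡ b)) + count (λ i → f (a ↑ʳ i))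
count-split zero b f = refl
count-split (suc a) b f =
  trans (cong (bit (f fzero) +_) (count-split a b (f ∘ fsuc))) (sym (+-assoc (bit (f fzero)) _ _))

count-remQuot : ∀ m n (f : Fin (suc m) × Fin n → Bool) →
  count {suc m * n} (f ∘ remQuot n) ≡
  count (λ i → f (fzero , i)) + count {m * n} (f ∘ map₁ fsuc ∘ remQuot n)
count-remQuot m n f = trans (count-split n (m * n) _) (cong₂ _+_ (count-cong first) (count-cong rest))
  where
  first : ∀ i → f (remQuot {suc m} n (i ↑ˡ (m * n))) ≡ f (fzero , i)
  first i rewrite splitAt-↑ˡ n i (m * n) = refl
  rest : ∀ j → f (remQuot {suc m} n (n ↑ʳ j)) ≡ f (map₁ fsuc (remQuot n j))
  rest j rewrite splitAt-↑ʳ n (m * n) j = refl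

size-by-type : ∀ {n} (S : EdgeSet n) →
  size S ≡ count (λ i → S (fzero , i))
           + (count (λ i → S (fsuc fzero , i)) + (count (λ i → S (fsuc (fsuc fzero) , i)) + 0))
size-by-type {n} S =
  trans (count-remQuot 2 n S)
    (cong (count (λ i → S (fzero , i)) +_)
      (trans (count-remQuot 1 n (S ∘ map₁ fsuc))
        (cong (count (λ i → S (fsuc fzero , i)) +_) (count-remQuot 0 n (S ∘ map₁ fsuc ∘ map₁ fsuc)))))

changes : (ℕ → Bool) → ℕ → ℕ
changes f N = ∑ N (λ m → bit (f m xor f (suc m)))

changes-cong : ∀ N {f g : ℕ → Bool} → (∀ m → m ≤ N → f m ≡ g m) → changes f N ≡ changes g N
changes-cong N eq = ∑-cong N (λ m m<N → cong₂ (λ x y → bit (x xor y)) (eq m (<⇒≤ m<N)) (eq (suc m) m<N))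

changes-split : ∀ a b (f : ℕ → Bool) → changes f (a + b) ≡ changes f a + changes (λ m → f (a + m)) b
changes-split a b f =
  trans (∑-split a b _)
        (cong (changes f a +_) (∑-cong b (λ m _ → cong (λ x → bit (f (a + m) xor f x)) (sym (+-suc a m)))))

changes-run : ∀ K′ (f : ℕ → Bool) {a : Bool} → (∀ m → m ≤ K′ → f m ≡ a) →
              changes f (suc K′) ≡ bit (a xor f (suc K′))
changes-run zero f const = trans (+-identityʳ _) (cong (λ x → bit (x xor f 1)) (const 0 z≤n))
changes-run (suc K′) f {a} const =
  cong₂ _+_ noChange (changes-run K′ (f ∘ suc) (λ m m≤K′ → const (suc m) (s≤s m≤K′)))
  where
  noChange : bit (f 0 xor f 1) ≡ 0
  noChange rewrite const 0 z≤n | const 1 (s≤s z≤n) = cong bit (xor-same a)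

glue : ℕ → (ℕ → Bool) → (ℕ → Bool) → ℕ → Bool
glue zero g f m = f m
glue (suc K) g f zero = g zero
glue (suc K) g f (suc m) = glue K (g ∘ suc) f m

glue-low : ∀ K g f {m} → m < K → glue K g f m ≡ g m
glue-low (suc K) g f {zero} _ = refl
glue-low (suc K) g f {suc m} m<K = glue-low K (g ∘ suc) f (s<s⁻¹ m<K)

glue-high : ∀ K g f m → glue K g f (K + m) ≡ f m
glue-high zero g f m = refl
glue-high (suc K) g f m = glue-high K (g ∘ suc) f m

changes-glue : ∀ K′ a f N →
               changes (glue (suc K′) (λ _ → a) f) (suc K′ + N) ≡ bit (a xor f 0) + changes f N
changes-glue K′ a f N = begin
  changes Θ (suc K′ + N)                                ≡⟨ changes-split (suc K′) N Θ ⟩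
  changes Θ (suc K′) + changes (λ m → Θ (suc K′ + m)) N ≡⟨ cong₂ _+_ firstBlock (changes-cong N (λ m _ → rest m)) ⟩
  bit (a xor f 0) + changes f N                         ∎
  where
  open ≡-Reasoning
  Θ : ℕ → Bool
  Θ = glue (suc K′) (λ _ → a) f
  rest : ∀ m → Θ (suc K′ + m) ≡ f m
  rest = glue-high (suc K′) (λ _ → a) f
  firstBlock : changes Θ (suc K′) ≡ bit (a xor f 0)
  firstBlock = trans (changes-run K′ Θ (λ m m≤K′ → glue-low (suc K′) (λ _ → a) f (s≤s m≤K′)))
                     (cong (λ x → bit (a xor x)) (trans (cong Θ (sym (+-identityʳ (suc K′)))) (rest 0)))

bit-xor-parity : ∀ x y z → (bit (x xor y) + bit (y xor z)) % 2 ≡ bit (x xor z) % 2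
bit-xor-parity false false z = refl
bit-xor-parity false true false = refl
bit-xor-parity false true true = refl
bit-xor-parity true false false = refl
bit-xor-parity true false true = refl
bit-xor-parity true true z = refl

changes-parity : ∀ N (f : ℕ → Bool) → changes f N % 2 ≡ bit (f 0 xor f N) % 2
changes-parity zero f = cong (λ x → bit x % 2) (sym (xor-same (f 0)))
changes-parity (suc N) f = begin
  (first + changes (f ∘ suc) N) % 2             ≡⟨ %-distribˡ-+ first _ 2 ⟩
  (first % 2 + changes (f ∘ suc) N % 2) % 2     ≡⟨ cong (λ x → (first % 2 + x) % 2) (changes-parity N (f ∘ suc)) ⟩
  (first % 2 + bit (f 1 xor f (suc N)) % 2) % 2 ≡⟨ %-distribˡ-+ first _ 2 ⟨
  (first + bit (f 1 xor f (suc N))) % 2         ≡⟨ bit-xor-parity (f 0) (f 1) (f (suc N)) ⟩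
  bit (f 0 xor f (suc N)) % 2                   ∎
  where
  open ≡-Reasoning
  first : ℕ
  first = bit (f 0 xor f 1)

-- Boolean identities: equal values have xor false; cancellation; and the relabelling used
-- on the outer rim, where p is a prefix sign and p xor s the next one
xor≡false⇒≡ : ∀ {x y} → x xor y ≡ false → x ≡ y
xor≡false⇒≡ {false} {false} _ = refl
xor≡false⇒≡ {true} {true} _ = refl

xor-cancelˡ : ∀ x y → x xor (x xor y) ≡ y
xor-cancelˡ x y = trans (sym (xor-assoc x x y)) (cong (_xor y) (xor-same x))

xor-shift : ∀ p s a b → s xor (a xor b) ≡ (p xor a) xor ((p xor s) xor b)
xor-shift false false a b = refl
xor-shift false true a b = not-distribʳ-xor a b
xor-shift true false a b = sym (xor-annihilates-not a b)
xor-shift true true a b = not-distribˡ-xor a b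

mod-toℕ : ∀ {N} .{{_ : NonZero N}} (i : Fin N) → toℕ i mod N ≡ i
mod-toℕ {N} i = toℕ-injective (trans (toℕ-fromℕ< _) (m<n⇒m%n≡m (toℕ<n i)))

cycle-parity : ∀ M (h : Fin (suc M) → Bool) → count (λ j → h j xor h (next j)) % 2 ≡ 0
cycle-parity M h = begin
  count (λ j → h j xor h (next j)) % 2       ≡⟨ cong (_% 2) (count-cong onIndices) ⟩
  count {suc M} (F ∘ toℕ) % 2                 ≡⟨ cong (_% 2) (count-∑ (suc M) F) ⟩
  changes H (suc M) % 2                      ≡⟨ changes-parity (suc M) H ⟩
  bit (H 0 xor H (suc M)) % 2                ≡⟨ cong (λ j → bit (H 0 xor h j) % 2) wrap ⟩
  bit (H 0 xor H 0) % 2                      ≡⟨ cong (λ x → bit x % 2) (xor-same (H 0)) ⟩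
  0                                          ∎
  where
  open ≡-Reasoning
  H : ℕ → Bool
  H i = h (i mod suc M)
  F : ℕ → Bool
  F i = H i xor H (suc i)
  onIndices : ∀ j → h j xor h (next j) ≡ F (toℕ j)
  onIndices j = cong₂ (λ x y → h x xor h y) (sym (mod-toℕ j)) (cong (_mod suc M) (+-comm (toℕ j) 1))
  wrap : suc M mod suc M ≡ 0 mod suc M
  wrap = toℕ-injective (trans (toℕ-fromℕ< _) (n%n≡0 (suc M)))

-- Switching a signature at σ : Vertex n → Bool negates every edge with exactly one end in σ;
-- `switched n k E₋ σ` is the set of edges that are negative afterwards.
switched : (n k : ℕ) → EdgeSet n → (Vertex n → Bool) → EdgeSet n
switched n k Eneg σ e = Eneg e xor (σ (proj₁ (ends n k e)) xor σ (proj₂ (ends n k e)))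

kept-sign : ∀ {n k Eneg} σ e {x y} →
            Joins n k e x y → switched n k Eneg σ e ≡ false → Eneg e ≡ σ x xor σ y
kept-sign σ e (inj₁ eq) pos rewrite eq = xor≡false⇒≡ pos
kept-sign σ e {x} {y} (inj₂ eq) pos rewrite eq = trans (xor≡false⇒≡ pos) (xor-comm (σ y) (σ x))

switching-balanced : ∀ n k Eneg σ → Balanced n k Eneg (switched n k Eneg σ)
switching-balanced n k Eneg σ C = balanced (len C) (len≥3 C) (vert C) (edge C) (joins C) (kept C)
  where
  open Cycle
  balanced : ∀ m → 3 ≤ m → (vert : Fin m → Vertex n) (edge : Fin m → Edge n) →
             (∀ j → Joins n k (edge j) (vert j) (vert (next j))) →
             (∀ j → switched n k Eneg σ (edge j) ≡ false) →
             count (λ j → Eneg (edge j)) % 2 ≡ 0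
  balanced (suc M) _ vert edge joins kept =
    trans (cong (_% 2) (count-cong (λ j → kept-sign {Eneg = Eneg} σ (edge j) (joins j) (kept j))))
          (cycle-parity M (σ ∘ vert))

toℕ-addMod : ∀ {n} .{{_ : NonZero n}} (i : Fin n) a → toℕ (addMod i a) ≡ (toℕ i + a) % n
toℕ-addMod {suc n} i a = toℕ-fromℕ< _

-- Signs of P_{n,k} indexed by ℕ (positions taken modulo n), and switchings described
-- by two sequences: u_i ↦ σu i and v_i ↦ σv i.
module RimSwitching (n k : ℕ) .{{_ : NonZero n}} (Eneg : EdgeSet n) where

  sign : Fin 3 → ℕ → Bool
  sign t m = Eneg (t , m mod n)

  outerSign innerSign spokeSign : ℕ → Bool
  outerSign = sign fzero
  innerSign = sign (fsuc fzero)
  spokeSign = sign (fsuc (fsuc fzero))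

  module _ (σu σv : ℕ → Bool) where

    rimσ : Vertex n → Bool
    rimσ (false , i) = σu (toℕ i)
    rimσ (true , i) = σv (toℕ i)

    outerNeg innerNeg spokeNeg : ℕ → Bool
    outerNeg m = outerSign m xor (σu m xor σu ((m + 1) % n))
    innerNeg m = innerSign m xor (σv m xor σv ((m + k) % n))
    spokeNeg m = spokeSign m xor (σu m xor σv m)

    size-switched : size (switched n k Eneg rimσ) ≡
                    ∑ n (bit ∘ outerNeg) + (∑ n (bit ∘ innerNeg) + (∑ n (bit ∘ spokeNeg) + 0))
    size-switched =
      trans (size-by-type (switched n k Eneg rimσ))
        (cong₂ _+_ (byIndex outerNeg outer)
          (cong₂ _+_ (byIndex innerNeg inner) (cong (_+ 0) (byIndex spokeNeg spoke))))
      where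
      byIndex : ∀ {t} (F : ℕ → Bool) → (∀ i → switched n k Eneg rimσ (t , i) ≡ F (toℕ i)) →
                count (λ i → switched n k Eneg rimσ (t , i)) ≡ ∑ n (bit ∘ F)
      byIndex F eq = trans (count-cong eq) (count-∑ n F)
      signAt : ∀ t i → Eneg (t , i) ≡ sign t (toℕ i)
      signAt t i = cong (λ j → Eneg (t , j)) (sym (mod-toℕ i))
      outer : ∀ i → switched n k Eneg rimσ (fzero , i) ≡ outerNeg (toℕ i)
      outer i = cong₂ (λ s j → s xor (σu (toℕ i) xor σu j)) (signAt fzero i) (toℕ-addMod i 1)
      inner : ∀ i → switched n k Eneg rimσ (fsuc fzero , i) ≡ innerNeg (toℕ i)
      inner i = cong₂ (λ s j → s xor (σv (toℕ i) xor σv j)) (signAt (fsuc fzero) i) (toℕ-addMod i k)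
      spoke : ∀ i → switched n k Eneg rimσ (fsuc (fsuc fzero) , i) ≡ spokeNeg (toℕ i)
      spoke i = cong (λ s → s xor (σu (toℕ i) xor σv (toℕ i))) (signAt (fsuc (fsuc fzero)) i)

Triple : Set
Triple = Bool × Bool × Bool

_⊕³_ : Triple → Triple → Triple
(x₀ , x₁ , x₂) ⊕³ (y₀ , y₁ , y₂) = (x₀ xor y₀ , x₁ xor y₁ , x₂ xor y₂)

allTriples : List Triple
allTriples = (false , false , false) ∷ (false , false , true) ∷ (false , true , false) ∷ (false , true , true) ∷
             (true , false , false) ∷ (true , false , true) ∷ (true , true , false) ∷ (true , true , true) ∷ []

triangleNeg : Triple → Triple → ℕ
triangleNeg (e₀ , e₁ , e₂) (w₀ , w₁ , w₂) =
  bit (e₀ xor (w₀ xor w₁)) + (bit (e₁ xor (w₁ xor w₂)) + bit (e₂ xor (w₂ xor w₀)))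

spokesNeg : Triple → Triple → ℕ
spokesNeg (q₀ , q₁ , q₂) (w₀ , w₁ , w₂) = bit (q₀ xor w₀) + (bit (q₁ xor w₁) + bit (q₂ xor w₂))

localCost : Triple → Triple → Triple → ℕ
localCost q e w = triangleNeg e w + spokesNeg q w

bestSwitch : Triple → Triple → Triple
bestSwitch q e = argmin (localCost q e) (false , false , false) allTriples

minCost : Triple → Triple → ℕ
minCost q e = localCost q e (bestSwitch q e)

choices : (Bool → Bool → ℕ) → ℕ
choices f = f false false + f false true + f true false + f true true

∀? : (Bool → Bool) → Bool
∀? p = p false ∧ p true

∀?-sound : (p : Bool → Bool) → T (∀? p) → (b : Bool) → T (p b)
∀?-sound p h false = proj₁ (Equivalence.to T-∧ h)
∀?-sound p h true = proj₂ (Equivalence.to T-∧ h)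

∀³? : (Triple → Bool) → Bool
∀³? p = ∀? λ a → ∀? λ b → ∀? λ c → p (a , b , c)

∀³?-sound : (p : Triple → Bool) → T (∀³? p) → (t : Triple) → T (p t)
∀³?-sound p h (a , b , c) =
  ∀?-sound (λ c → p (a , b , c))
    (∀?-sound (λ b → ∀? λ c → p (a , b , c))
      (∀?-sound (λ a → ∀? λ b → ∀? λ c → p (a , b , c)) h a) b) c

averageBound? : Triple → Triple → Bool
averageBound? x e = choices (λ b c → minCost (x ⊕³ (false , b , c)) e) ≤ᵇ 5

-- Flipping the spokes at v₁ and v₂ in all four ways, the optimal costs add up to at most 5.
-- (Viewing the spokes as edges to one extra vertex, minCost is half the number of negative
-- triangles of a signed K₄; the four flips realise all four sign patterns of one parity,
-- giving total 3 or 5.)  Checked by evaluation over all 64 cases.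
triangle-bound : ∀ x e → choices (λ b c → minCost (x ⊕³ (false , b , c)) e) ≤ 5
triangle-bound x e =
  ≤ᵇ⇒≤ _ 5 (∀³?-sound (averageBound? x) (∀³?-sound (λ x → ∀³? (averageBound? x)) _ x) e)

choices-cong : ∀ {f g : Bool → Bool → ℕ} → (∀ b c → f b c ≡ g b c) → choices f ≡ choices g
choices-cong eq =
  cong₂ _+_ (cong₂ _+_ (cong₂ _+_ (eq false false) (eq false true)) (eq true false)) (eq true true)

choices-+ : ∀ (f g : Bool → Bool → ℕ) → choices (λ b c → f b c + g b c) ≡ choices f + choices g
choices-+ f g = regroup (f false false) (g false false) (f false true) (g false true)
                        (f true false) (g true false) (f true true) (g true true)
  where
  regroup : ∀ a a′ b b′ c c′ d d′ →
            (a + a′) + (b + b′) + (c + c′) + (d + d′) ≡ (a + b + c + d) + (a′ + b′ + c′ + d′)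
  regroup = solve-∀

choices-∑ : ∀ N (h : Bool → Bool → ℕ → ℕ) →
            choices (λ b c → ∑ N (h b c)) ≡ ∑ N (λ j → choices (λ b c → h b c j))
choices-∑ zero h = refl
choices-∑ (suc N) h =
  trans (choices-+ (λ b c → h b c 0) (λ b c → ∑ N (h b c ∘ suc)))
        (cong (choices (λ b c → h b c 0) +_) (choices-∑ N (λ b c → h b c ∘ suc)))

pigeonhole : ∀ B (f : Bool → Bool → ℕ) → choices f ≤ 4 * B + 3 → ∃₂ λ b c → f b c ≤ B
pigeonhole B f total with f false false ≤? B | f false true ≤? B | f true false ≤? B | f true true ≤? B
... | yes p | _     | _     | _     = false , false , p
... | no _  | yes p | _     | _     = false , true , p
... | no _  | no _  | yes p | _     = true , false , p
... | no _  | no _  | no _  | yes p = true , true , p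
... | no p  | no q  | no r  | no s  = ⊥-elim (<-irrefl refl (≤-trans tooLarge total))
  where
  tooLarge : 4 * B + 3 < choices f
  tooLarge = subst (_≤ choices f) (four B)
                   (+-mono-≤ (+-mono-≤ (+-mono-≤ (≰⇒> p) (≰⇒> q)) (≰⇒> r)) (≰⇒> s))
    where
    four : ∀ B → suc B + suc B + suc B + suc B ≡ suc (4 * B + 3)
    four = solve-∀

averaging-fits : ∀ K → K * 5 + 6 ≤ 4 * (⌊ 3 * K /2⌋ + 2) + 3
averaging-fits K = begin
  K * 5 + 6                ≤⟨ m≤m+n (K * 5 + 6) (K + 3) ⟩
  K * 5 + 6 + (K + 3)      ≡⟨ twice K ⟩
  2 * (3 * K) + 9          ≤⟨ +-monoˡ-≤ 9 (*-monoʳ-≤ 2 (odd-half (3 * K))) ⟩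
  2 * (F + suc F) + 9      ≡⟨ quad F ⟩
  4 * (F + 2) + 3          ∎
  where
  open ≤-Reasoning
  F = ⌊ 3 * K /2⌋
  odd-half : ∀ m → m ≤ ⌊ m /2⌋ + suc ⌊ m /2⌋
  odd-half m = subst (_≤ ⌊ m /2⌋ + suc ⌊ m /2⌋) (⌊n/2⌋+⌈n/2⌉≡n m)
                     (+-monoʳ-≤ ⌊ m /2⌋ (⌊n/2⌋-mono (n≤1+n (suc m))))
  twice : ∀ K → K * 5 + 6 + (K + 3) ≡ 2 * (3 * K) + 9
  twice = solve-∀
  quad : ∀ F → 2 * (F + suc F) + 9 ≡ 4 * (F + 2) + 3
  quad = solve-∀

module ThreeK (K′ : ℕ) (Eneg : EdgeSet (3 * suc K′)) where

  K n : ℕ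
  K = suc K′
  n = 3 * K

  open RimSwitching n K Eneg

  π : ℕ → Bool
  π zero = false
  π (suc m) = π m xor outerSign m

  atTriangle : (ℕ → Bool) → ℕ → Triple
  atTriangle f j = (f j , f (K + j) , f (K + (K + j)))

  atTriangle-cong : ∀ {f g : ℕ → Bool} → (∀ m → f m ≡ g m) → ∀ j → atTriangle f j ≡ atTriangle g j
  atTriangle-cong eq j = cong₂ _,_ (eq j) (cong₂ _,_ (eq (K + j)) (eq (K + (K + j))))

  atTriangle-glue : ∀ g₀ g₁ g₂ f {j} → j < K →
                    atTriangle (glue K g₀ (glue K g₁ (glue K g₂ f))) j ≡ (g₀ j , g₁ j , g₂ j)
  atTriangle-glue g₀ g₁ g₂ f {j} j<K = cong₂ _,_ (glue-low K g₀ _ j<K) (cong₂ _,_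
    (trans (glue-high K g₀ _ j) (glue-low K g₁ _ j<K))
    (trans (glue-high K g₀ _ (K + j)) (trans (glue-high K g₁ _ j) (glue-low K g₂ f j<K))))

  ∑-triangles : ∀ f → ∑ n f ≡ ∑ K (λ j → f j + (f (K + j) + f (K + (K + j))))
  ∑-triangles f = begin
    ∑ n f                                    ≡⟨ ∑-split K (K + (K + 0)) f ⟩
    ∑ K f + ∑ (K + (K + 0)) f₁               ≡⟨ cong (∑ K f +_) (∑-split K (K + 0) f₁) ⟩
    ∑ K f + (∑ K f₁ + ∑ (K + 0) f₂)          ≡⟨ cong (λ x → ∑ K f + (∑ K f₁ + x)) lastBlock ⟩
    ∑ K f + (∑ K f₁ + ∑ K f₂)                ≡⟨ cong (∑ K f +_) (∑-+ K f₁ f₂) ⟨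
    ∑ K f + ∑ K (λ j → f₁ j + f₂ j)          ≡⟨ ∑-+ K f (λ j → f₁ j + f₂ j) ⟨
    ∑ K (λ j → f j + (f₁ j + f₂ j))          ∎
    where
    open ≡-Reasoning
    f₁ f₂ : ℕ → ℕ
    f₁ j = f (K + j)
    f₂ j = f (K + (K + j))
    lastBlock : ∑ (K + 0) f₂ ≡ ∑ K f₂
    lastBlock = trans (∑-split K 0 f₂) (+-identityʳ (∑ K f₂))

  module _ {j : ℕ} (j<K : j < K) where
    private
      j<n : j < n
      j<n = m≤n⇒m≤n+o (K + (K + 0)) j<K
      K+j<n : K + j < n
      K+j<n = +-monoʳ-< K (m≤n⇒m≤n+o (K + 0) j<K)
      K+K+j<n : K + (K + j) < n
      K+K+j<n = +-monoʳ-< K (+-monoʳ-< K (m≤n⇒m≤n+o 0 j<K))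

    rotate₀ : (j + K) % n ≡ K + j
    rotate₀ = trans (cong (_% n) (+-comm j K)) (m<n⇒m%n≡m K+j<n)

    rotate₁ : (K + j + K) % n ≡ K + (K + j)
    rotate₁ = trans (cong (_% n) (+-comm (K + j) K)) (m<n⇒m%n≡m K+K+j<n)

    rotate₂ : (K + (K + j) + K) % n ≡ j
    rotate₂ = trans (cong (_% n) (threeK K j)) (trans ([m+n]%n≡m%n j n) (m<n⇒m%n≡m j<n))
      where
      threeK : ∀ K j → K + (K + j) + K ≡ j + 3 * K
      threeK = solve-∀

  module _ (σu σv : ℕ → Bool) where

    switchedSpoke : ℕ → Bool
    switchedSpoke m = spokeSign m xor σu m

    triangles-cost : ∑ n (bit ∘ innerNeg σu σv) + ∑ n (bit ∘ spokeNeg σu σv) ≡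
                     ∑ K (λ j → localCost (atTriangle switchedSpoke j) (atTriangle innerSign j) (atTriangle σv j))
    triangles-cost = begin
      ∑ n I + ∑ n P                                 ≡⟨ cong₂ _+_ (∑-triangles I) (∑-triangles P) ⟩
      ∑ K (atTriangle³ I) + ∑ K (atTriangle³ P)     ≡⟨ ∑-+ K (atTriangle³ I) (atTriangle³ P) ⟨
      ∑ K (λ j → atTriangle³ I j + atTriangle³ P j) ≡⟨ ∑-cong K (λ j j<K → cong₂ _+_ (edges j<K) (spokes {j})) ⟩
      ∑ K (λ j → localCost (atTriangle switchedSpoke j) (atTriangle innerSign j) (atTriangle σv j)) ∎
      where
      open ≡-Reasoning
      atTriangle³ : (ℕ → ℕ) → ℕ → ℕ
      atTriangle³ f j = f j + (f (K + j) + f (K + (K + j)))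
      I P : ℕ → ℕ
      I = bit ∘ innerNeg σu σv
      P = bit ∘ spokeNeg σu σv
      edge : ∀ {m m′} → (m + K) % n ≡ m′ → I m ≡ bit (innerSign m xor (σv m xor σv m′))
      edge {m} eq = cong (λ x → bit (innerSign m xor (σv m xor σv x))) eq
      edges : ∀ {j} → j < K → atTriangle³ I j ≡ triangleNeg (atTriangle innerSign j) (atTriangle σv j)
      edges j<K = cong₂ _+_ (edge (rotate₀ j<K)) (cong₂ _+_ (edge (rotate₁ j<K)) (edge (rotate₂ j<K)))
      spoke : ∀ m → P m ≡ bit (switchedSpoke m xor σv m)
      spoke m = cong bit (sym (xor-assoc (spokeSign m) (σu m) (σv m)))
      spokes : ∀ {j} → atTriangle³ P j ≡ spokesNeg (atTriangle switchedSpoke j) (atTriangle σv j)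
      spokes {j} = cong₂ _+_ (spoke j) (cong₂ _+_ (spoke (K + j)) (spoke (K + (K + j))))

    outer-cost : σu n ≡ σu 0 → ∑ n (bit ∘ outerNeg σu σv) ≡ changes (λ m → π m xor σu m) n
    outer-cost closed = ∑-cong n λ m m<n →
      cong bit (trans (cong (λ x → outerSign m xor (σu m xor x)) (wrap m<n))
                      (xor-shift (π m) (outerSign m) (σu m) (σu (suc m))))
      where
      wrap : ∀ {m} → m < n → σu ((m + 1) % n) ≡ σu (suc m)
      wrap {m} m<n with m≤n⇒m<n∨m≡n m<n
      ... | inj₁ 1+m<n = cong σu (trans (cong (_% n) (+-comm m 1)) (m<n⇒m%n≡m 1+m<n))
      ... | inj₂ 1+m≡n = trans (cong σu (trans (cong (_% n) (trans (+-comm m 1) 1+m≡n)) (n%n≡0 n)))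
                               (trans (sym closed) (cong σu (sym 1+m≡n)))

  spokes inners : ℕ → Triple
  spokes = atTriangle (λ m → spokeSign m xor π m)
  inners = atTriangle innerSign

  outerCost : Bool → Bool → ℕ
  outerCost b c = bit b + (bit (b xor c) + (bit (c xor π n) + 0))

  triangleCost : Bool → Bool → ℕ → ℕ
  triangleCost b c j = minCost (spokes j ⊕³ (false , b , c)) (inners j)

  module Choice (b c : Bool) where

    Θ Θ₁ Θ₂ : ℕ → Bool
    Θ = glue K (λ _ → false) Θ₁
    Θ₁ = glue K (λ _ → b) Θ₂
    Θ₂ = glue K (λ _ → c) (λ _ → π n)

    σu : ℕ → Bool
    σu m = π m xor Θ m

    w : ℕ → Triple
    w j = bestSwitch (spokes j ⊕³ (false , b , c)) (inners j)

    σv : ℕ → Bool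
    σv = glue K (proj₁ ∘ w) (glue K (proj₁ ∘ proj₂ ∘ w) (glue K (proj₂ ∘ proj₂ ∘ w) (λ _ → false)))

    σ : Vertex n → Bool
    σ = rimσ σu σv

    -- σu closes up: both ends of the outer rim get π n xor π n = false
    closed : σu n ≡ σu 0
    closed = trans (cong (π n xor_) Θ-end) (xor-same (π n))
      where
      Θ-end : Θ n ≡ π n
      Θ-end = trans (glue-high K (λ _ → false) Θ₁ (K + (K + 0)))
              (trans (glue-high K (λ _ → b) Θ₂ (K + 0)) (glue-high K (λ _ → c) (λ _ → π n) 0))

    outer : ∑ n (bit ∘ outerNeg σu σv) ≡ outerCost b c
    outer = begin
      ∑ n (bit ∘ outerNeg σu σv)                   ≡⟨ outer-cost σu σv closed ⟩
      changes (λ m → π m xor σu m) n               ≡⟨ changes-cong n (λ m _ → xor-cancelˡ (π m) (Θ m)) ⟩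
      changes Θ n                                  ≡⟨ changes-glue K′ false Θ₁ (K + (K + 0)) ⟩
      bit b + changes Θ₁ (K + (K + 0))             ≡⟨ cong (bit b +_) (changes-glue K′ b Θ₂ (K + 0)) ⟩
      bit b + (bit (b xor c) + changes Θ₂ (K + 0)) ≡⟨ cong (λ x → bit b + (bit (b xor c) + x)) lastBlock ⟩
      outerCost b c                                ∎
      where
      open ≡-Reasoning
      lastBlock : changes Θ₂ (K + 0) ≡ bit (c xor π n) + 0
      lastBlock = changes-glue K′ c (λ _ → π n) 0

    triangle : ∀ {j} → j < K →
               localCost (atTriangle (switchedSpoke σu σv) j) (inners j) (atTriangle σv j) ≡ triangleCost b c j
    triangle {j} j<K = cong₂ (λ q w′ → localCost q (inners j) w′) spokes-flipped (atTriangle-glue _ _ _ _ j<K)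
      where
      spokes-flipped : atTriangle (switchedSpoke σu σv) j ≡ spokes j ⊕³ (false , b , c)
      spokes-flipped =
        trans (atTriangle-cong (λ m → sym (xor-assoc (spokeSign m) (π m) (Θ m))) j)
              (cong (spokes j ⊕³_) (atTriangle-glue _ _ _ _ j<K))

    size-choice : size (switched n K Eneg σ) ≡ outerCost b c + ∑ K (triangleCost b c)
    size-choice =
      trans (size-switched σu σv)
        (cong₂ _+_ outer (trans (cong (∑ n (bit ∘ innerNeg σu σv) +_) (+-identityʳ _))
                         (trans (triangles-cost σu σv) (∑-cong K (λ j → triangle)))))

  cost : Bool → Bool → ℕ
  cost b c = size (switched n K Eneg (Choice.σ b c))

  -- each outer block boundary is negative for exactly two of the four choices
  outer-average : choices outerCost ≡ 6
  outer-average = sixFlips (π n)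
    where
    sixFlips : ∀ p → choices (λ b c → bit b + (bit (b xor c) + (bit (c xor p) + 0))) ≡ 6
    sixFlips false = refl
    sixFlips true = refl

  averaged-cost : choices cost ≤ K * 5 + 6
  averaged-cost = begin
    choices cost                                          ≡⟨ choices-cong Choice.size-choice ⟩
    choices (λ b c → outerCost b c + triangles b c)       ≡⟨ choices-+ outerCost triangles ⟩
    choices outerCost + choices triangles                 ≡⟨ cong₂ _+_ outer-average (choices-∑ K triangleCost) ⟩
    6 + ∑ K (λ j → choices (λ b c → triangleCost b c j)) ≤⟨ +-monoʳ-≤ 6 (∑-mono K local) ⟩
    6 + ∑ K (λ _ → 5)                                     ≡⟨ cong (6 +_) (∑-const K 5) ⟩
    6 + K * 5                                             ≡⟨ +-comm 6 (K * 5) ⟩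
    K * 5 + 6                                             ∎
    where
    open ≤-Reasoning
    triangles : Bool → Bool → ℕ
    triangles b c = ∑ K (triangleCost b c)
    local : ∀ j → choices (λ b c → triangleCost b c j) ≤ 5
    local j = triangle-bound (spokes j) (inners j)

theorem4p2 : (k : ℕ) → 2 ≤ k → MaxFrustrationAtMost (3 * k) k (⌊ 3 * k /2⌋ + 2)
theorem4p2 zero ()
theorem4p2 (suc K′) _ Eneg =
  let (b , c , small) = pigeonhole (⌊ 3 * K /2⌋ + 2) cost (≤-trans averaged-cost (averaging-fits K))
  in switched n K Eneg (Choice.σ b c) , small , switching-balanced n K Eneg (Choice.σ b c)
  where open ThreeK K′ Eneg
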